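{- For every $n\ge1$, the average number of descents of $\mathrm{Flatten}(\pi)$, taken over all $\pi\in\mathcal S_n$, equals $\frac{(n-1)(n-2)}{2n}$.
   Context: $\mathcal S_n$ is the set of permutations of $[n]$. For $\pi\in\mathcal S_n$ written in standard cycle form (each cycle begins with its smallest element, cycles ordered left to right by increasing smallest elements), $\mathrm{Flatten}(\pi)$ is the word obtained by erasing the parentheses. A descent of a word $w_1\cdots w_n$ is an index $i$ with $w_i>w_{i+1}$. -}

module Defs where

open import Data.Nat using (ℕ; zero; suc; _+_; _*_; _∸_; _≡ᵇ_; _<ᵇ_; _≟_)
open import Data.Bool using (Bool; true; false; if_then_else_)
open import Data.List using (List; []; _∷_; map; length; filter; concatMap; upTo; _++_)
open import Data.Bool.ListAction using (any)
open import Data.Nat.ListAction using (sum)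
open import Data.List.Relation.Unary.Unique.DecPropositional _≟_ using (unique?)

[_] : ℕ → List ℕ
[ n ] = map suc (upTo n)

words : List ℕ → ℕ → List (List ℕ)
words xs zero    = [] ∷ []
words xs (suc k) = concatMap (λ x → map (x ∷_) (words xs k)) xs

-- S_n: permutations of [n] in one-line notation w = σ(1)⋯σ(n),
-- i.e. the words of length n over [n] without repeated letters.
S : ℕ → List (List ℕ)
S n = filter (λ w → unique? w) (words [ n ] n)

-- σ(i) for σ in one-line notation (positions 1-based; 0 outside [n])
apply : List ℕ → ℕ → ℕ
apply []       _             = 0
apply (x ∷ _)  (suc zero)    = x
apply (_ ∷ xs) (suc (suc i)) = apply xs (suc i)
apply (_ ∷ _)  zero          = 0

-- the cycle of σ through i, written starting at i: i σ(i) σ²(i) …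
-- (fuel n suffices since cycles have length ≤ n)
cycleRest : List ℕ → ℕ → ℕ → ℕ → List ℕ
cycleRest σ i zero    j = []
cycleRest σ i (suc k) j = if j ≡ᵇ i then [] else j ∷ cycleRest σ i k (apply σ j)

cycleOf : List ℕ → ℕ → ℕ → List ℕ
cycleOf σ n i = i ∷ cycleRest σ i n (apply σ i)

elem : ℕ → List ℕ → Bool
elem x xs = any (x ≡ᵇ_) xs

-- standard cycle form, parentheses erased: scan i = 1,…,n in increasing order;
-- each i not yet seen starts a new cycle (it is then the smallest element of its cycle).
flattenFrom : List ℕ → ℕ → List ℕ → List ℕ → List ℕ
flattenFrom σ n seen []       = []
flattenFrom σ n seen (i ∷ is) =
  if elem i seen then flattenFrom σ n seen is
  else (cycleOf σ n i ++ flattenFrom σ n (cycleOf σ n i ++ seen) is)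

Flatten : ℕ → List ℕ → List ℕ
Flatten n σ = flattenFrom σ n [] [ n ]

des : List ℕ → ℕ
des []            = 0
des (x ∷ [])      = 0
des (x ∷ y ∷ ws)  = (if y <ᵇ x then 1 else 0) + des (y ∷ ws)

totalDes : ℕ → ℕ
totalDes n = sum (map (λ π → des (Flatten n π)) (S n))

-- Every permutation of [N+1] arises from exactly one permutation σ of [N], either by appending
-- N+1 as a fixed point or by splicing N+1 into a cycle right after some m ∈ [N].  On the
-- flattened word the first operation appends the maximal letter N+1, creating no descent, and the
-- second inserts N+1 right after the letter m, which adds one descent exactly when m is followed
-- by a larger letter.  Summing over m thus adds the N - 1 - des(Flatten σ) ascents of Flatten σ,
-- so the total T N of descents over S N satisfies T (N+1) = N · T N + N! · (N - 1), and hence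
-- 2 · T (N+1) = N! · N · (N - 1).

module Submission where

open import Defs
open import Data.Nat.Base using (ℕ; zero; suc; _+_; _*_; _∸_; _≤_; _<_; z≤n; s≤s; z<s; _≡ᵇ_; _<ᵇ_; _!)
open import Data.Nat.Properties
open import Algebra.Properties.CommutativeSemigroup +-commutativeSemigroup using (interchange)
open import Data.Nat.ListAction using (sum)
open import Data.Nat.ListAction.Properties using (sum-++; sum-↭)
open import Data.Nat.Tactic.RingSolver using (solve-∀)
open import Data.Bool.Base using (true; false; if_then_else_)
open import Data.Product.Base using (∃; _×_; _,_; proj₂)
open import Data.Sum.Base using (_⊎_; inj₁; inj₂)
open import Data.List.Base
  using (List; []; _∷_; _++_; length; map; filter; concatMap; upTo; initLast; _∷ʳ′_)
open import Data.List.Properties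
  using (length-map; length-upTo; length-++; map-++; map-∘; ++-assoc; ++-identityˡ-unique; ++-identityʳ;
         ∷-injectiveˡ; ∷-injectiveʳ; applyUpTo-∷ʳ; filter-all; filter-notAll; length-filter)
open import Data.List.Relation.Unary.All as All using (All; []; _∷_)
open import Data.List.Relation.Unary.Any as Any using (here; there)
open import Data.List.Relation.Unary.Any.Properties using (any⁺; any⁻)
open import Data.List.Relation.Unary.Unique.Propositional using (Unique)
open import Data.List.Relation.Unary.AllPairs as AllPairs using (AllPairs)
open import Data.List.Relation.Unary.AllPairs.Properties using () renaming (map⁺ to AllPairs-map⁺)
open import Data.List.Relation.Unary.All.Properties
  using (¬Any⇒All¬; All¬⇒¬Any) renaming (map⁺ to All-map⁺)
import Data.List.Relation.Unary.Unique.Propositional.Properties as Unique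
open import Data.List.Membership.Propositional using (_∈_; _∉_; find)
open import Data.List.Membership.Propositional.Properties
open import Data.List.Membership.Propositional.Properties.WithK using (unique∧set⇒bag)
open import Data.List.Relation.Unary.Unique.DecPropositional _≟_ using (unique?)
open import Data.List.Relation.Binary.Disjoint.Propositional using (Disjoint)
open import Data.List.Relation.Binary.Permutation.Propositional
  using (_↭_; ↭-sym; ↭-trans; ↭-prep; ↭-swap; ↭-refl; ↭⇒↭ₛ)
open import Data.List.Relation.Binary.Permutation.Propositional.Properties
  using (↭-length; ↭-empty-inv; ∈-resp-↭; ∷↭∷ʳ; drop-mid; ++⁺ʳ; ++⁺ˡ)
  renaming (map⁺ to ↭-map⁺)
import Data.List.Relation.Binary.Permutation.Setoid.Properties as PermutationSetoid
open import Data.List.Relation.Binary.BagAndSetEquality using (∼bag⇒↭)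
open import Function.Base using (_∘_)
open import Function.Bundles using (_⇔_; mk⇔; module Equivalence)
open import Relation.Binary.PropositionalEquality
  using (_≡_; _≢_; refl; sym; trans; cong; cong₂; subst; setoid; module ≡-Reasoning)
open import Relation.Nullary.Negation using (contradiction)
open import Relation.Nullary.Decidable using (yes; no; _because_; dec-true; dec-false)
open import Relation.Binary.Core using (Rel)
open import Relation.Binary.Definitions using (DecidableEquality)
open import Relation.Nullary.Reflects using (Reflects; ofʸ; ofⁿ; fromEquivalence)

≡ᵇ-reflects : ∀ m n → Reflects (m ≡ n) (m ≡ᵇ n)
≡ᵇ-reflects m n = fromEquivalence (≡ᵇ⇒≡ m n) (≡⇒≡ᵇ m n)

≡ᵇ-refl : ∀ n → (n ≡ᵇ n) ≡ true
≡ᵇ-refl n = dec-true (n ≟ n) refl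

≢⇒≡ᵇ≡false : ∀ {m n} → m ≢ n → (m ≡ᵇ n) ≡ false
≢⇒≡ᵇ≡false {m} {n} = dec-false (m ≟ n)

<⇒<ᵇ≡true : ∀ {m n} → m < n → (m <ᵇ n) ≡ true
<⇒<ᵇ≡true {m} {n} = dec-true (m <? n)

≤⇒<ᵇ≡false : ∀ {m n} → n ≤ m → (m <ᵇ n) ≡ false
≤⇒<ᵇ≡false {m} {n} n≤m = dec-false (m <? n) (≤⇒≯ n≤m)

elem-reflects : ∀ x xs → Reflects (x ∈ xs) (elem x xs)
elem-reflects x xs = fromEquivalence
  (Any.map (≡ᵇ⇒≡ x _) ∘ any⁻ (x ≡ᵇ_) xs) (any⁺ (x ≡ᵇ_) ∘ Any.map (≡⇒≡ᵇ x _))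

∈⇒elem≡true : ∀ {x xs} → x ∈ xs → elem x xs ≡ true
∈⇒elem≡true {x} {xs} = dec-true (elem x xs because elem-reflects x xs)

∉⇒elem≡false : ∀ {x xs} → x ∉ xs → elem x xs ≡ false
∉⇒elem≡false {x} {xs} = dec-false (elem x xs because elem-reflects x xs)

module _ {a} {A : Set a} (_≟ᴬ_ : DecidableEquality A) where
  open import Data.List.Membership.DecPropositional _≟ᴬ_ using () renaming (_∈?_ to _∈ᴬ?_)

  private
    ↭-filter : ∀ {xs ys : List A} → Unique xs → Unique ys → All (_∈ ys) xs →
               xs ↭ filter (_∈ᴬ? xs) ys
    ↭-filter {xs} {ys} uxs uys xs⊆ys = ∼bag⇒↭ (unique∧set⇒bag uxs (Unique.filter⁺ (_∈ᴬ? xs) uys)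
      (mk⇔ (λ x∈xs → ∈-filter⁺ (_∈ᴬ? xs) (All.lookup xs⊆ys x∈xs) x∈xs)
           (λ x∈ → proj₂ (∈-filter⁻ (_∈ᴬ? xs) {xs = ys} x∈))))

  length-unique-⊆ : ∀ {xs ys : List A} → Unique xs → Unique ys → All (_∈ ys) xs →
                    length xs ≤ length ys
  length-unique-⊆ {xs} {ys} uxs uys xs⊆ys =
    ≤-trans (≤-reflexive (↭-length (↭-filter uxs uys xs⊆ys))) (length-filter (_∈ᴬ? xs) ys)

  unique-⊆-length⇒↭ : ∀ {xs ys : List A} → Unique xs → Unique ys → All (_∈ ys) xs →
                      length ys ≤ length xs → xs ↭ ys
  unique-⊆-length⇒↭ {xs} {ys} uxs uys xs⊆ys ys≤xs =
    subst (xs ↭_) (filter-all (_∈ᴬ? xs) (All.tabulate covered)) xs↭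
    where
    xs↭ = ↭-filter uxs uys xs⊆ys
    covered : ∀ {y} → y ∈ ys → y ∈ xs
    covered {y} y∈ys with y ∈ᴬ? xs
    ... | yes y∈xs = y∈xs
    ... | no y∉xs = contradiction (≤-trans ys≤xs (≤-reflexive (↭-length xs↭)))
                      (<⇒≱ (filter-notAll (_∈ᴬ? xs) ys (Any.map (λ { refl → y∉xs }) y∈ys)))

AllPairs-map-on : ∀ {a b r s p} {A : Set a} {B : Set b} {R : Rel A r} {S : Rel B s} {P : A → Set p}
                  {f : A → B} {xs} → (∀ {x y} → P x → P y → R x y → S (f x) (f y)) →
                  All P xs → AllPairs R xs → AllPairs S (map f xs)
AllPairs-map-on pres []         AllPairs.[]         = AllPairs.[]
AllPairs-map-on pres (px ∷ pxs) (rxs AllPairs.∷ rs) =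
  All-map⁺ (All.zipWith (λ (pxy , py) → pres px py pxy) (rxs , pxs)) AllPairs.∷ AllPairs-map-on pres pxs rs

InRange : ℕ → ℕ → Set
InRange N x = 1 ≤ x × x ≤ N

InRange-suc : ∀ {N x} → InRange N x → InRange (suc N) x
InRange-suc (1≤x , x≤N) = 1≤x , m≤n⇒m≤1+n x≤N

InRange-top : ∀ N → InRange (suc N) (suc N)
InRange-top N = s≤s z≤n , ≤-refl

InRange⇒≢suc : ∀ {N x} → InRange N x → x ≢ suc N
InRange⇒≢suc (_ , x≤N) refl = 1+n≰n x≤N

InRange-pred : ∀ {N x} → InRange (suc N) x → x ≢ suc N → InRange N x
InRange-pred (1≤x , x≤1+N) x≢1+N = 1≤x , ≤-pred (≤∧≢⇒< x≤1+N x≢1+N)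

All-InRange⇒suc∉ : ∀ {N w} → All (InRange N) w → suc N ∉ w
All-InRange⇒suc∉ ws x∈ = InRange⇒≢suc (All.lookup ws x∈) refl

[_]-suc : ∀ N → [ suc N ] ≡ [ N ] ++ suc N ∷ []
[ N ]-suc = trans (cong (map suc) (sym (applyUpTo-∷ʳ (λ x → x) N))) (map-++ suc (upTo N) (N ∷ []))

length-[_] : ∀ N → length [ N ] ≡ N
length-[ N ] = trans (length-map suc (upTo N)) (length-upTo N)

unique-[_] : ∀ N → Unique [ N ]
unique-[ N ] = Unique.map⁺ suc-injective (Unique.upTo⁺ N)

∈-[]⁺ : ∀ {N x} → InRange N x → x ∈ [ N ]
∈-[]⁺ {x = suc x} (_ , x<N) = ∈-map⁺ suc (∈-upTo⁺ x<N)

∈-[]⁻ : ∀ {N x} → x ∈ [ N ] → InRange N x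
∈-[]⁻ x∈ with _ , y∈ , refl ← ∈-map⁻ suc x∈ = s≤s z≤n , ∈-upTo⁻ y∈

[]-InRange : ∀ N → All (InRange N) [ N ]
[]-InRange N = All.tabulate ∈-[]⁻

↭[]-suc : ∀ {N w} → w ↭ [ N ] → w ++ suc N ∷ [] ↭ [ suc N ]
↭[]-suc {N} {w} w↭ = subst (w ++ suc N ∷ [] ↭_) (sym [ N ]-suc) (++⁺ʳ _ w↭)

module _ {N : ℕ} {w : List ℕ} (w↭ : w ↭ [ N ]) where

  ↭[]⇒length : length w ≡ N
  ↭[]⇒length = trans (↭-length w↭) length-[ N ]

  ↭[]⇒InRange : All (InRange N) w
  ↭[]⇒InRange = All.tabulate (λ x∈ → ∈-[]⁻ (∈-resp-↭ w↭ x∈))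

  ↭[]⇒unique : Unique w
  ↭[]⇒unique = PermutationSetoid.Unique-resp-↭ (setoid ℕ) (↭⇒↭ₛ (↭-sym w↭)) unique-[ N ]

  ↭[]⇒∈ : ∀ {x} → InRange N x → x ∈ w
  ↭[]⇒∈ x∈N = ∈-resp-↭ (↭-sym w↭) (∈-[]⁺ x∈N)

unique-InRange-length⇒↭[] : ∀ {N w} → Unique w → All (InRange N) w → length w ≡ N → w ↭ [ N ]
unique-InRange-length⇒↭[] {N} uw inR len =
  unique-⊆-length⇒↭ _≟_ uw unique-[ N ] (All.map ∈-[]⁺ inR)
    (≤-reflexive (trans length-[ N ] (sym len)))

length-unique-InRange : ∀ {N w} → Unique w → All (InRange N) w → length w ≤ N
length-unique-InRange {N} uw inR =
  ≤-trans (length-unique-⊆ _≟_ uw unique-[ N ] (All.map ∈-[]⁺ inR)) (≤-reflexive length-[ N ])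

apply-++ˡ : ∀ xs {ys x} → x ≤ length xs → apply (xs ++ ys) x ≡ apply xs x
apply-++ˡ []       {[]}    {zero}            _        = refl
apply-++ˡ []       {_ ∷ _} {zero}            _        = refl
apply-++ˡ (_ ∷ _)          {x = zero}        _        = refl
apply-++ˡ (_ ∷ _)          {x = suc zero}    _        = refl
apply-++ˡ (_ ∷ xs)         {x = suc (suc x)} (s≤s x≤) = apply-++ˡ xs x≤

apply-mid : ∀ xs y ys → apply (xs ++ y ∷ ys) (suc (length xs)) ≡ y
apply-mid []       y ys = refl
apply-mid (_ ∷ xs) y ys = apply-mid xs y ys

apply-∷ʳ-other : ∀ xs y {x} → x ≢ suc (length xs) → apply (xs ++ y ∷ []) x ≡ apply xs x
apply-∷ʳ-other []       y {zero}        _  = refl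
apply-∷ʳ-other []       y {suc zero}    x≢ = contradiction refl x≢
apply-∷ʳ-other []       y {suc (suc x)} _  = refl
apply-∷ʳ-other (_ ∷ _)  y {zero}        _  = refl
apply-∷ʳ-other (_ ∷ _)  y {suc zero}    _  = refl
apply-∷ʳ-other (_ ∷ xs) y {suc (suc x)} x≢ = apply-∷ʳ-other xs y (x≢ ∘ cong suc)

apply-∈ : ∀ xs {x} → InRange (length xs) x → apply xs x ∈ xs
apply-∈ (_ ∷ _)  {suc zero}    _            = here refl
apply-∈ (_ ∷ xs) {suc (suc x)} (_ , s≤s x≤) = there (apply-∈ xs (s≤s z≤n , x≤))

apply-ext : ∀ xs ys → length xs ≡ length ys →
            (∀ {x} → InRange (length xs) x → apply xs x ≡ apply ys x) → xs ≡ ys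
apply-ext []       []       _   _    = refl
apply-ext (a ∷ xs) (b ∷ ys) len same = cong₂ _∷_ (same (s≤s z≤n , s≤s z≤n))
  (apply-ext xs ys (suc-injective len) λ { {suc x} (_ , x≤) → same (s≤s z≤n , s≤s x≤) })

setAt : List ℕ → ℕ → ℕ → List ℕ
setAt []       _             v = []
setAt (x ∷ xs) zero          v = x ∷ xs
setAt (x ∷ xs) (suc zero)    v = v ∷ xs
setAt (x ∷ xs) (suc (suc i)) v = x ∷ setAt xs (suc i) v

length-setAt : ∀ xs i v → length (setAt xs i v) ≡ length xs
length-setAt []       _             v = refl
length-setAt (x ∷ xs) zero          v = refl
length-setAt (x ∷ xs) (suc zero)    v = refl
length-setAt (x ∷ xs) (suc (suc i)) v = cong suc (length-setAt xs (suc i) v)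

apply-setAt-same : ∀ xs {i} v → InRange (length xs) i → apply (setAt xs i v) i ≡ v
apply-setAt-same (_ ∷ _)  {suc zero}    v _            = refl
apply-setAt-same (_ ∷ xs) {suc (suc i)} v (_ , s≤s i≤) = apply-setAt-same xs v (s≤s z≤n , i≤)

apply-setAt-other : ∀ xs {i} v {x} → x ≢ i → apply (setAt xs i v) x ≡ apply xs x
apply-setAt-other []                     v               x≢i = refl
apply-setAt-other (_ ∷ _)  {zero}        v {_}           x≢i = refl
apply-setAt-other (_ ∷ _)  {suc zero}    v {zero}        x≢i = refl
apply-setAt-other (_ ∷ _)  {suc zero}    v {suc zero}    x≢i = contradiction refl x≢i
apply-setAt-other (_ ∷ _)  {suc zero}    v {suc (suc x)} x≢i = refl
apply-setAt-other (_ ∷ _)  {suc (suc i)} v {zero}        x≢i = refl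
apply-setAt-other (_ ∷ _)  {suc (suc i)} v {suc zero}    x≢i = refl
apply-setAt-other (_ ∷ xs) {suc (suc i)} v {suc (suc x)} x≢i = apply-setAt-other xs v (x≢i ∘ cong suc)

setAt-mid : ∀ xs y ys v → setAt (xs ++ y ∷ ys) (suc (length xs)) v ≡ xs ++ v ∷ ys
setAt-mid []       y ys v = refl
setAt-mid (x ∷ xs) y ys v = cong (x ∷_) (setAt-mid xs y ys v)

-- Walks and cycles

data Walk (f : ℕ → ℕ) (i : ℕ) : ℕ → List ℕ → Set where
  done : Walk f i i []
  step : ∀ {j ws} → j ≢ i → Walk f i (f j) ws → Walk f i j (j ∷ ws)

Periodic : (ℕ → ℕ) → ℕ → Set
Periodic f i = ∃ λ ws → Walk f i (f i) ws

walk-deterministic : ∀ {f i j ws vs} → Walk f i j ws → Walk f i j vs → ws ≡ vs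
walk-deterministic done         done         = refl
walk-deterministic done         (step j≢i _) = contradiction refl j≢i
walk-deterministic (step j≢i _) done         = contradiction refl j≢i
walk-deterministic (step _ w)   (step _ v)   = cong (_ ∷_) (walk-deterministic w v)

walk-suffix : ∀ {f i j x ys} xs → Walk f i j (xs ++ x ∷ ys) → Walk f i x (x ∷ ys)
walk-suffix []       w@(step _ _) = w
walk-suffix (_ ∷ xs) (step _ w)   = walk-suffix xs w

walk-unique : ∀ {f i j ws} → Walk f i j ws → Unique ws
walk-unique done = AllPairs.[]
walk-unique w@(step _ w′) = ¬Any⇒All¬ _ (head∉ w) AllPairs.∷ walk-unique w′
  where
  head∉ : ∀ {f i j ws} → Walk f i j (j ∷ ws) → j ∉ ws
  head∉ w j∈ws with xs , ys , refl ← ∈-∃++ j∈ws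
    with () ← ++-identityˡ-unique (_ ∷ xs) (walk-deterministic (walk-suffix (_ ∷ xs) w) w)

walk-All : ∀ {P : ℕ → Set} {f i j ws} → (∀ {x} → P x → P (f x)) → P j →
           Walk f i j ws → All P ws
walk-All f-pres Pj done       = []
walk-All f-pres Pj (step _ w) = Pj ∷ walk-All f-pres (f-pres Pj) w

step-≡ : ∀ {f i j k ws} → j ≢ i → f j ≡ k → Walk f i k ws → Walk f i j (j ∷ ws)
step-≡ j≢i refl w = step j≢i w

walk-agree : ∀ {f g n i j ws} → (∀ {x} → x ≢ n → g x ≡ f x) → n ∉ ws →
             Walk f i j ws → Walk g i j ws
walk-agree agree n∉ done         = done
walk-agree agree n∉ (step j≢i w) =
  step-≡ j≢i (agree (λ { refl → n∉ (here refl) })) (walk-agree agree (n∉ ∘ there) w)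

walk-cycleRest : ∀ {σ i j ws} k → Walk (apply σ) i j ws → length ws ≤ k → cycleRest σ i k j ≡ ws
walk-cycleRest         zero    done         _       = refl
walk-cycleRest {i = i} (suc k) done         _       rewrite ≡ᵇ-refl i = refl
walk-cycleRest         (suc k) (step j≢i w) (s≤s l) rewrite ≢⇒≡ᵇ≡false j≢i =
  cong (_ ∷_) (walk-cycleRest k w l)

module _ {N : ℕ} {σ : List ℕ} (σ↭ : σ ↭ [ N ]) where

  apply-InRange : ∀ {x} → InRange N x → InRange N (apply σ x)
  apply-InRange {x} (1≤x , x≤N) =
    All.lookup (↭[]⇒InRange σ↭) (apply-∈ σ (1≤x , subst (x ≤_) (sym (↭[]⇒length σ↭)) x≤N))

  walk-InRange : ∀ {i ws} → InRange N i → Walk (apply σ) i (apply σ i) ws → All (InRange N) ws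
  walk-InRange i∈ = walk-All apply-InRange (apply-InRange i∈)

  cycleOf-walk : ∀ {i ws} → InRange N i → Walk (apply σ) i (apply σ i) ws → cycleOf σ N i ≡ i ∷ ws
  cycleOf-walk i∈ w = cong (_ ∷_)
    (walk-cycleRest N w (length-unique-InRange (walk-unique w) (walk-InRange i∈ w)))

cycleIfNew : List ℕ → ℕ → List ℕ → ℕ → List ℕ
cycleIfNew σ N seen i = if elem i seen then [] else cycleOf σ N i

flattenFrom-∷ : ∀ σ N seen i is → flattenFrom σ N seen (i ∷ is) ≡
                cycleIfNew σ N seen i ++ flattenFrom σ N (cycleIfNew σ N seen i ++ seen) is
flattenFrom-∷ σ N seen i is with elem i seen
... | true  = refl
... | false = refl

∈-cycleIfNew++ : ∀ σ N seen i → i ∈ cycleIfNew σ N seen i ++ seen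
∈-cycleIfNew++ σ N seen i with elem i seen | elem-reflects i seen
... | true  | ofʸ i∈seen = i∈seen
... | false | _          = here refl

-- Splicing a new point into a cycle

insertAfter : ℕ → ℕ → List ℕ → List ℕ
insertAfter m n []       = []
insertAfter m n (x ∷ xs) = if x ≡ᵇ m then x ∷ n ∷ insertAfter m n xs else x ∷ insertAfter m n xs

module _ {m n : ℕ} where

  insertAfter-++ : ∀ xs ys → insertAfter m n (xs ++ ys) ≡ insertAfter m n xs ++ insertAfter m n ys
  insertAfter-++ []       ys = refl
  insertAfter-++ (x ∷ xs) ys with x ≡ᵇ m
  ... | true  = cong (λ zs → x ∷ n ∷ zs) (insertAfter-++ xs ys)
  ... | false = cong (x ∷_) (insertAfter-++ xs ys)

  insertAfter-∉ : ∀ xs → m ∉ xs → insertAfter m n xs ≡ xs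
  insertAfter-∉ []       _   = refl
  insertAfter-∉ (x ∷ xs) m∉ with x ≡ᵇ m | ≡ᵇ-reflects x m
  ... | true  | ofʸ refl = contradiction (here refl) m∉
  ... | false | ofⁿ _    = cong (x ∷_) (insertAfter-∉ xs (m∉ ∘ there))

  elem-insertAfter : ∀ {x} xs → x ≢ n → elem x (insertAfter m n xs) ≡ elem x xs
  elem-insertAfter []       x≢n = refl
  elem-insertAfter (y ∷ xs) x≢n with y ≡ᵇ m
  ... | true  rewrite ≢⇒≡ᵇ≡false x≢n | elem-insertAfter xs x≢n = refl
  ... | false rewrite elem-insertAfter xs x≢n = refl

  ∈-insertAfter : ∀ xs → m ∈ xs → n ∈ insertAfter m n xs
  ∈-insertAfter (x ∷ xs) m∈ with x ≡ᵇ m | ≡ᵇ-reflects x m | m∈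
  ... | true  | _        | _          = there (here refl)
  ... | false | ofⁿ x≢m  | here refl  = contradiction refl x≢m
  ... | false | _        | there m∈xs = there (∈-insertAfter xs m∈xs)

  insertAfter-↭ : ∀ {xs} → Unique xs → m ∈ xs → insertAfter m n xs ↭ xs ++ n ∷ []
  insertAfter-↭ {x ∷ xs} (x∉xs AllPairs.∷ uxs) m∈ with x ≡ᵇ m | ≡ᵇ-reflects x m | m∈
  ... | true  | ofʸ refl | _ rewrite insertAfter-∉ xs (All¬⇒¬Any x∉xs) = ↭-prep x (∷↭∷ʳ n xs)
  ... | false | ofⁿ x≢m  | here refl  = contradiction refl x≢m
  ... | false | _        | there m∈xs = ↭-prep x (insertAfter-↭ uxs m∈xs)

record Splices (f g : ℕ → ℕ) (m n : ℕ) : Set where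
  field
    at-m      : g m ≡ n
    at-n      : g n ≡ f m
    elsewhere : ∀ {x} → x ≢ m → x ≢ n → g x ≡ f x

module _ {f g m n} (S : Splices f g m n) where
  open Splices S

  walk-splice : ∀ {i j ws} → i ≢ n → n ∉ ws → Walk f i j ws → Walk g i j (insertAfter m n ws)
  walk-splice i≢n n∉ done = done
  walk-splice i≢n n∉ (step {j} j≢i w) with j ≡ᵇ m | ≡ᵇ-reflects j m
  ... | true  | ofʸ refl =
    step-≡ j≢i at-m (step-≡ (i≢n ∘ sym) at-n (walk-splice i≢n (n∉ ∘ there) w))
  ... | false | ofⁿ j≢m  =
    step-≡ j≢i (elsewhere j≢m (λ { refl → n∉ (here refl) })) (walk-splice i≢n (n∉ ∘ there) w)

  cycle-splice : ∀ {i ws} → i ≢ n → n ∉ ws → Walk f i (f i) ws →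
                 ∃ λ ws′ → Walk g i (g i) ws′ × i ∷ ws′ ≡ insertAfter m n (i ∷ ws)
  cycle-splice {i} {ws} i≢n n∉ w with i ≡ᵇ m | ≡ᵇ-reflects i m
  ... | true  | ofʸ refl =
    n ∷ insertAfter m n ws , subst (λ k → Walk g m k _) (sym at-m)
      (step-≡ (i≢n ∘ sym) at-n (walk-splice i≢n n∉ w)) , refl
  ... | false | ofⁿ i≢m  =
    insertAfter m n ws ,
    subst (λ k → Walk g i k _) (sym (elsewhere i≢m i≢n)) (walk-splice i≢n n∉ w) , refl

  cycle-splice-new : ∀ {ws} → m ≢ n → n ∉ ws → Walk f m (f m) ws → Walk g n (g n) (ws ++ m ∷ [])
  cycle-splice-new m≢n n∉ w = subst (λ k → Walk g n k _) (sym at-n) (go n∉ w)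
    where
    go : ∀ {j ws} → n ∉ ws → Walk f m j ws → Walk g n j (ws ++ m ∷ [])
    go n∉ done         = step-≡ m≢n at-m done
    go n∉ (step j≢m w) = step-≡ (λ { refl → n∉ (here refl) })
      (elsewhere j≢m (λ { refl → n∉ (here refl) })) (go (n∉ ∘ there) w)

-- Extending a permutation of [ N ] to one of [ N + 1 ]

appendFixed-agrees : ∀ {N} σ → length σ ≡ N →
                     ∀ {x} → x ≢ suc N → apply (σ ++ suc N ∷ []) x ≡ apply σ x
appendFixed-agrees σ refl = apply-∷ʳ-other σ _

appendFixed-new : ∀ {N} σ → length σ ≡ N → apply (σ ++ suc N ∷ []) (suc N) ≡ suc N
appendFixed-new σ refl = apply-mid σ _ []

insertInCycle : List ℕ → ℕ → ℕ → List ℕ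
insertInCycle σ m n = setAt σ m n ++ apply σ m ∷ []

insertInCycle-mid : ∀ xs y ys v →
                    insertInCycle (xs ++ y ∷ ys) (suc (length xs)) v ≡ xs ++ v ∷ ys ++ y ∷ []
insertInCycle-mid xs y ys v =
  trans (cong₂ (λ zs z → zs ++ z ∷ []) (setAt-mid xs y ys v) (apply-mid xs y ys))
        (++-assoc xs (v ∷ ys) (y ∷ []))

insertInCycle-↭ : ∀ σ {m} v → InRange (length σ) m → insertInCycle σ m v ↭ σ ++ v ∷ []
insertInCycle-↭ (x ∷ xs) {suc zero}    v _ = ↭-trans (↭-prep v (↭-sym (∷↭∷ʳ x xs)))
  (↭-trans (↭-swap v x ↭-refl) (↭-prep x (∷↭∷ʳ v xs)))
insertInCycle-↭ (x ∷ xs) {suc (suc i)} v (_ , s≤s i≤) =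
  ↭-prep x (insertInCycle-↭ xs v (s≤s z≤n , i≤))

insertInCycle-splices : ∀ {N} σ {m} → length σ ≡ N → InRange N m →
                        Splices (apply σ) (apply (insertInCycle σ m (suc N))) m (suc N)
insertInCycle-splices σ {m} refl m∈ = record
  { at-m      = trans (apply-++ˡ (setAt σ m n) (subst (m ≤_) (sym len) (proj₂ m∈)))
                      (apply-setAt-same σ n m∈)
  ; at-n      = subst (λ k → apply (insertInCycle σ m n) (suc k) ≡ apply σ m) len
                      (apply-mid (setAt σ m n) (apply σ m) [])
  ; elsewhere = λ {x} x≢m x≢n →
      trans (apply-∷ʳ-other (setAt σ m n) (apply σ m) (subst (x ≢_) (cong suc (sym len)) x≢n))
            (apply-setAt-other σ n x≢m)
  }
  where
  n = suc (length σ)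
  len = length-setAt σ m n

record IsPermutation (N : ℕ) (σ : List ℕ) : Set where
  field
    perm     : σ ↭ [ N ]
    periodic : ∀ {i} → InRange N i → Periodic (apply σ) i
    flatten  : Flatten N σ ↭ [ N ]

  cycleOf-InRange : ∀ {i} → InRange N i → All (InRange N) (cycleOf σ N i)
  cycleOf-InRange i∈ with ws , w ← periodic i∈ =
    subst (All (InRange N)) (sym (cycleOf-walk perm i∈ w)) (i∈ ∷ walk-InRange perm i∈ w)

isPermutation-[] : IsPermutation 0 []
isPermutation-[] = record { perm = ↭-refl ; periodic = λ { (() , z≤n) } ; flatten = ↭-refl }

module AppendFixed {N σ} (P : IsPermutation N σ) where
  open IsPermutation P
  open ≡-Reasoning

  private
    n = suc N
    σ⁺ = σ ++ n ∷ []
    agrees = appendFixed-agrees σ (↭[]⇒length perm)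
    σ⁺↭ = ↭[]-suc perm

    walk-old : ∀ {i ws} → InRange N i →
               Walk (apply σ) i (apply σ i) ws → Walk (apply σ⁺) i (apply σ⁺ i) ws
    walk-old {i} {ws} i∈ w = subst (λ k → Walk (apply σ⁺) i k ws) (sym (agrees (InRange⇒≢suc i∈)))
      (walk-agree agrees (All-InRange⇒suc∉ (walk-InRange perm i∈ w)) w)

    walk-new : Walk (apply σ⁺) n (apply σ⁺ n) []
    walk-new = subst (λ k → Walk (apply σ⁺) n k []) (sym (appendFixed-new σ (↭[]⇒length perm))) done

    cycleIfNew-old : ∀ seen {i} → InRange N i → cycleIfNew σ⁺ n seen i ≡ cycleIfNew σ N seen i
    cycleIfNew-old seen {i} i∈ with elem i seen | periodic i∈
    ... | true  | _      = refl
    ... | false | ws , w = begin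
      cycleOf σ⁺ n i ≡⟨ cycleOf-walk σ⁺↭ (InRange-suc i∈) (walk-old i∈ w) ⟩
      i ∷ ws         ≡⟨ cycleOf-walk perm i∈ w ⟨
      cycleOf σ N i  ∎

    cycleIfNew-InRange : ∀ seen {i} → InRange N i → All (InRange N) (cycleIfNew σ N seen i)
    cycleIfNew-InRange seen {i} i∈ with elem i seen
    ... | true  = []
    ... | false = cycleOf-InRange i∈

    flattenFrom-old : ∀ is seen → All (InRange N) is → n ∉ seen →
                      flattenFrom σ⁺ n seen (is ++ n ∷ []) ≡ flattenFrom σ N seen is ++ n ∷ []
    flattenFrom-old [] seen [] n∉ = begin
      flattenFrom σ⁺ n seen (n ∷ [])
        ≡⟨ cong (if_then [] else (cycleOf σ⁺ n n ++ [])) (∉⇒elem≡false n∉) ⟩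
      cycleOf σ⁺ n n ++ []
        ≡⟨ cong (_++ []) (cycleOf-walk σ⁺↭ (InRange-top N) walk-new) ⟩
      n ∷ [] ∎
    flattenFrom-old (i ∷ is) seen (i∈ ∷ is∈) n∉ = begin
      flattenFrom σ⁺ n seen (i ∷ is ++ n ∷ [])
        ≡⟨ flattenFrom-∷ σ⁺ n seen i (is ++ n ∷ []) ⟩
      cycleIfNew σ⁺ n seen i ++ flattenFrom σ⁺ n (cycleIfNew σ⁺ n seen i ++ seen) (is ++ n ∷ [])
        ≡⟨ cong (λ C → C ++ flattenFrom σ⁺ n (C ++ seen) (is ++ n ∷ []))
                (cycleIfNew-old seen i∈) ⟩
      C ++ flattenFrom σ⁺ n (C ++ seen) (is ++ n ∷ [])
        ≡⟨ cong (C ++_) (flattenFrom-old is (C ++ seen) is∈ n∉C++seen) ⟩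
      C ++ (flattenFrom σ N (C ++ seen) is ++ n ∷ [])
        ≡⟨ ++-assoc C _ _ ⟨
      (C ++ flattenFrom σ N (C ++ seen) is) ++ n ∷ []
        ≡⟨ cong (_++ n ∷ []) (flattenFrom-∷ σ N seen i is) ⟨
      flattenFrom σ N seen (i ∷ is) ++ n ∷ [] ∎
      where
      C = cycleIfNew σ N seen i
      n∉C++seen : n ∉ C ++ seen
      n∉C++seen n∈ with ∈-++⁻ C n∈
      ... | inj₁ n∈C    = All-InRange⇒suc∉ (cycleIfNew-InRange seen i∈) n∈C
      ... | inj₂ n∈seen = n∉ n∈seen

  Flatten-appendFixed : Flatten n σ⁺ ≡ Flatten N σ ++ n ∷ []
  Flatten-appendFixed =
    trans (cong (flattenFrom σ⁺ n []) [ N ]-suc) (flattenFrom-old [ N ] [] ([]-InRange N) λ ())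

  isPermutation : IsPermutation n σ⁺
  isPermutation = record
    { perm     = σ⁺↭
    ; periodic = periodic⁺
    ; flatten  = subst (_↭ [ n ]) (sym Flatten-appendFixed) (↭[]-suc flatten)
    }
    where
    periodic⁺ : ∀ {i} → InRange n i → Periodic (apply σ⁺) i
    periodic⁺ {i} i∈ with i ≟ n
    ... | yes refl = [] , walk-new
    ... | no i≢n with ws , w ← periodic (InRange-pred i∈ i≢n) =
      ws , walk-old (InRange-pred i∈ i≢n) w

module InsertInCycle {N σ m} (P : IsPermutation N σ) (m∈ : InRange N m) where
  open IsPermutation P
  open ≡-Reasoning

  private
    n = suc N
    σ′ = insertInCycle σ m n
    splices = insertInCycle-splices σ (↭[]⇒length perm) m∈
    σ′↭ : σ′ ↭ [ n ]
    σ′↭ = ↭-trans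
      (insertInCycle-↭ σ n (subst (λ k → InRange k m) (sym (↭[]⇒length perm)) m∈)) (↭[]-suc perm)

    n∉walk : ∀ {i ws} → InRange N i → Walk (apply σ) i (apply σ i) ws → n ∉ ws
    n∉walk i∈ w = All-InRange⇒suc∉ (walk-InRange perm i∈ w)

    cycleIfNew-old : ∀ seen {i} → InRange N i →
                     cycleIfNew σ′ n (insertAfter m n seen) i ≡ insertAfter m n (cycleIfNew σ N seen i)
    cycleIfNew-old seen {i} i∈ rewrite elem-insertAfter {m} {n} seen (InRange⇒≢suc i∈)
      with elem i seen | periodic i∈
    ... | true  | _      = refl
    ... | false | ws , w
      with ws′ , w′ , ws′≡ ← cycle-splice splices (InRange⇒≢suc i∈) (n∉walk i∈ w) w = begin
      cycleOf σ′ n i                  ≡⟨ cycleOf-walk σ′↭ (InRange-suc i∈) w′ ⟩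
      i ∷ ws′                         ≡⟨ ws′≡ ⟩
      insertAfter m n (i ∷ ws)        ≡⟨ cong (insertAfter m n) (cycleOf-walk perm i∈ w) ⟨
      insertAfter m n (cycleOf σ N i) ∎

    -- m is still to be emitted or already seen, so n is seen by the time n itself is scanned
    flattenFrom-old : ∀ is seen → All (InRange N) is → m ∈ seen ⊎ m ∈ is →
      flattenFrom σ′ n (insertAfter m n seen) (is ++ n ∷ []) ≡ insertAfter m n (flattenFrom σ N seen is)
    flattenFrom-old [] seen [] (inj₁ m∈seen) =
      cong (if_then [] else (cycleOf σ′ n n ++ [])) (∈⇒elem≡true (∈-insertAfter seen m∈seen))
    flattenFrom-old (i ∷ is) seen (i∈ ∷ is∈) m∈ = begin
      flattenFrom σ′ n (ins seen) (i ∷ is ++ n ∷ [])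
        ≡⟨ flattenFrom-∷ σ′ n (ins seen) i (is ++ n ∷ []) ⟩
      C′ ++ flattenFrom σ′ n (C′ ++ ins seen) (is ++ n ∷ [])
        ≡⟨ cong (λ D → D ++ flattenFrom σ′ n (D ++ ins seen) (is ++ n ∷ []))
                (cycleIfNew-old seen i∈) ⟩
      ins C ++ flattenFrom σ′ n (ins C ++ ins seen) (is ++ n ∷ [])
        ≡⟨ cong (λ s → ins C ++ flattenFrom σ′ n s (is ++ n ∷ [])) (insertAfter-++ C seen) ⟨
      ins C ++ flattenFrom σ′ n (ins (C ++ seen)) (is ++ n ∷ [])
        ≡⟨ cong (ins C ++_) (flattenFrom-old is (C ++ seen) is∈ (advance m∈)) ⟩
      ins C ++ ins (flattenFrom σ N (C ++ seen) is)
        ≡⟨ insertAfter-++ C _ ⟨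
      ins (C ++ flattenFrom σ N (C ++ seen) is)
        ≡⟨ cong ins (flattenFrom-∷ σ N seen i is) ⟨
      ins (flattenFrom σ N seen (i ∷ is)) ∎
      where
      ins = insertAfter m n
      C = cycleIfNew σ N seen i
      C′ = cycleIfNew σ′ n (ins seen) i
      advance : m ∈ seen ⊎ m ∈ i ∷ is → m ∈ C ++ seen ⊎ m ∈ is
      advance (inj₁ m∈seen)       = inj₁ (∈-++⁺ʳ C m∈seen)
      advance (inj₂ (here refl))  = inj₁ (∈-cycleIfNew++ σ N seen i)
      advance (inj₂ (there m∈is)) = inj₂ m∈is

  Flatten-insertInCycle : Flatten n σ′ ≡ insertAfter m n (Flatten N σ)
  Flatten-insertInCycle = trans (cong (flattenFrom σ′ n []) [ N ]-suc)
    (flattenFrom-old [ N ] [] ([]-InRange N) (inj₂ (∈-[]⁺ m∈)))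

  isPermutation : IsPermutation n σ′
  isPermutation = record
    { perm     = σ′↭
    ; periodic = periodic′
    ; flatten  = subst (_↭ [ n ]) (sym Flatten-insertInCycle)
        (↭-trans (insertAfter-↭ (↭[]⇒unique flatten) (↭[]⇒∈ flatten m∈)) (↭[]-suc flatten))
    }
    where
    periodic′ : ∀ {i} → InRange n i → Periodic (apply σ′) i
    periodic′ {i} i∈ with i ≟ n
    ... | yes refl with ws , w ← periodic m∈ =
      ws ++ m ∷ [] , cycle-splice-new splices (InRange⇒≢suc m∈) (n∉walk m∈ w) w
    ... | no i≢n with ws , w ← periodic (InRange-pred i∈ i≢n)
      with ws′ , w′ , _ ← cycle-splice splices i≢n (n∉walk (InRange-pred i∈ i≢n) w) w = ws′ , w′

-- Enumerating the permutations

extensions : ℕ → List ℕ → List (List ℕ)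
extensions N σ = (σ ++ suc N ∷ []) ∷ map (λ m → insertInCycle σ m (suc N)) [ N ]

perms : ℕ → List (List ℕ)
perms zero    = [] ∷ []
perms (suc N) = concatMap (extensions N) (perms N)

extensions-isPermutation : ∀ {N σ c} → IsPermutation N σ → c ∈ extensions N σ →
                           IsPermutation (suc N) c
extensions-isPermutation P (here refl) = AppendFixed.isPermutation P
extensions-isPermutation P (there c∈) with m , m∈ , refl ← ∈-map⁻ _ c∈ =
  InsertInCycle.isPermutation P (∈-[]⁻ m∈)

perms-isPermutation : ∀ N {σ} → σ ∈ perms N → IsPermutation N σ
perms-isPermutation zero    (here refl) = isPermutation-[]
perms-isPermutation (suc N) σ∈
  with τ , τ∈ , σ∈ext ← find (∈-concatMap⁻ (extensions N) {xs = perms N} σ∈) =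
  extensions-isPermutation (perms-isPermutation N τ∈) σ∈ext

∈-extensions : ∀ {N} xs ys → xs ++ ys ↭ [ N ] →
               ∃ λ σ → σ ↭ [ N ] × xs ++ suc N ∷ ys ∈ extensions N σ
∈-extensions {N} xs ys xs++ys↭ with initLast ys
... | []        = xs , subst (_↭ _) (++-identityʳ xs) xs++ys↭ , here refl
... | ys′ ∷ʳ′ y = σ , σ↭ ,
  there (subst (_∈ map (λ m → insertInCycle σ m (suc N)) [ N ]) (insertInCycle-mid xs y ys′ (suc N))
    (∈-map⁺ (λ m → insertInCycle σ m (suc N)) (∈-[]⁺ (s≤s z≤n , m≤N))))
  where
  σ = xs ++ y ∷ ys′
  σ↭ = ↭-trans (++⁺ˡ xs (∷↭∷ʳ y ys′)) xs++ys↭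
  m≤N = subst (suc (length xs) ≤_) (trans (sym (length-++ xs)) (↭[]⇒length σ↭))
              (m<m+n (length xs) z<s)

perms-complete : ∀ N {w} → w ↭ [ N ] → w ∈ perms N
perms-complete zero    w↭ with refl ← ↭-empty-inv w↭ = here refl
perms-complete (suc N) w↭ with xs , ys , refl ← ∈-∃++ (↭[]⇒∈ w↭ (InRange-top N))
  with σ , σ↭ , w∈ ← ∈-extensions xs ys (subst (xs ++ ys ↭_) (++-identityʳ [ N ])
         (drop-mid xs [ N ] (subst (xs ++ suc N ∷ ys ↭_) [ N ]-suc w↭))) =
  ∈-concatMap⁺ (extensions N) (Any.map (λ { refl → w∈ }) (perms-complete N σ↭))

unsplice : ℕ → (ℕ → ℕ) → ℕ → ℕ
unsplice n g x = if g x ≡ᵇ n then g n else g x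

unsplice-agrees : ∀ {f g : ℕ → ℕ} {n x} → (∀ {y} → y ≢ n → g y ≡ f y) →
                  x ≢ n → f x ≢ n → unsplice n g x ≡ f x
unsplice-agrees agrees x≢n fx≢n rewrite agrees x≢n | ≢⇒≡ᵇ≡false fx≢n = refl

unsplice-splices : ∀ {f g : ℕ → ℕ} {m n x} → Splices f g m n →
                   x ≢ n → f x ≢ n → unsplice n g x ≡ f x
unsplice-splices {m = m} {n} {x} S x≢n fx≢n with x ≟ m
... | yes refl rewrite Splices.at-m S | ≡ᵇ-refl n = Splices.at-n S
... | no x≢m rewrite Splices.elsewhere S x≢m x≢n | ≢⇒≡ᵇ≡false fx≢n = refl

unsplice-extensions : ∀ {N σ c} → σ ↭ [ N ] → c ∈ extensions N σ →
                      ∀ {x} → InRange N x → unsplice (suc N) (apply c) x ≡ apply σ x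
unsplice-extensions {σ = σ} σ↭ (here refl) x∈ =
  unsplice-agrees (appendFixed-agrees σ (↭[]⇒length σ↭))
    (InRange⇒≢suc x∈) (InRange⇒≢suc (apply-InRange σ↭ x∈))
unsplice-extensions {σ = σ} σ↭ (there c∈) x∈ with m , m∈ , refl ← ∈-map⁻ _ c∈ =
  unsplice-splices (insertInCycle-splices σ (↭[]⇒length σ↭) (∈-[]⁻ m∈))
    (InRange⇒≢suc x∈) (InRange⇒≢suc (apply-InRange σ↭ x∈))

extensions-injective : ∀ {N σ τ c} → σ ↭ [ N ] → τ ↭ [ N ] →
                       c ∈ extensions N σ → c ∈ extensions N τ → σ ≡ τ
extensions-injective {N} {σ} {τ} σ↭ τ↭ c∈σ c∈τ =
  apply-ext σ τ (trans (↭[]⇒length σ↭) (sym (↭[]⇒length τ↭))) λ {x} (1≤x , x≤) →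
    let x∈ = 1≤x , subst (x ≤_) (↭[]⇒length σ↭) x≤ in
    trans (sym (unsplice-extensions σ↭ c∈σ x∈)) (unsplice-extensions τ↭ c∈τ x∈)

extensions-unique : ∀ {N σ} → σ ↭ [ N ] → Unique (extensions N σ)
extensions-unique {N} {σ} σ↭ =
  ¬Any⇒All¬ _ fixed∉ AllPairs.∷ AllPairs-map-on distinct ([]-InRange N) unique-[ N ]
  where
  n = suc N
  splices : ∀ {m} → InRange N m → Splices (apply σ) (apply (insertInCycle σ m n)) m n
  splices = insertInCycle-splices σ (↭[]⇒length σ↭)

  fixed∉ : σ ++ n ∷ [] ∉ map (λ m → insertInCycle σ m n) [ N ]
  fixed∉ c∈ with m , m∈ , eq ← ∈-map⁻ _ c∈ = InRange⇒≢suc (apply-InRange σ↭ (∈-[]⁻ m∈)) (begin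
    apply σ m
      ≡⟨ appendFixed-agrees σ (↭[]⇒length σ↭) (InRange⇒≢suc (∈-[]⁻ m∈)) ⟨
    apply (σ ++ n ∷ []) m         ≡⟨ cong (λ c → apply c m) eq ⟩
    apply (insertInCycle σ m n) m ≡⟨ Splices.at-m (splices (∈-[]⁻ m∈)) ⟩
    n                             ∎)
    where open ≡-Reasoning

  distinct : ∀ {x y} → InRange N x → InRange N y → x ≢ y →
             insertInCycle σ x n ≢ insertInCycle σ y n
  distinct {x} {y} x∈ y∈ x≢y eq = InRange⇒≢suc (apply-InRange σ↭ x∈) (begin
    apply σ x                     ≡⟨ Splices.elsewhere (splices y∈) x≢y (InRange⇒≢suc x∈) ⟨
    apply (insertInCycle σ y n) x ≡⟨ cong (λ c → apply c x) eq ⟨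
    apply (insertInCycle σ x n) x ≡⟨ Splices.at-m (splices x∈) ⟩
    n                             ∎)
    where open ≡-Reasoning

perms-unique : ∀ N → Unique (perms N)
perms-unique zero    = [] AllPairs.∷ AllPairs.[]
perms-unique (suc N) = Unique.concat⁺
  (All-map⁺ (All.tabulate (extensions-unique ∘ perm ∘ perms-isPermutation N)))
  (AllPairs-map-on (λ σ↭ τ↭ σ≢τ (c∈σ , c∈τ) → σ≢τ (extensions-injective σ↭ τ↭ c∈σ c∈τ))
    (All.tabulate (perm ∘ perms-isPermutation N)) (perms-unique N))
  where open IsPermutation

∈-words⁺ : ∀ xs k {w} → length w ≡ k → All (_∈ xs) w → w ∈ words xs k
∈-words⁺ xs zero    {[]}    _   []          = here refl
∈-words⁺ xs (suc k) {y ∷ w} len (y∈ ∷ w∈) =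
  ∈-concatMap⁺ (λ x → map (x ∷_) (words xs k))
    (Any.map (λ { refl → ∈-map⁺ (y ∷_) (∈-words⁺ xs k (suc-injective len) w∈) }) y∈)

∈-words⁻ : ∀ xs k {w} → w ∈ words xs k → length w ≡ k × All (_∈ xs) w
∈-words⁻ xs zero    (here refl) = refl , []
∈-words⁻ xs (suc k) w∈
  with x , x∈ , w∈′ ← find (∈-concatMap⁻ (λ x → map (x ∷_) (words xs k)) {xs = xs} w∈)
  with v , v∈ , refl ← ∈-map⁻ (x ∷_) w∈′
  with len , v∈xs ← ∈-words⁻ xs k v∈ = cong suc len , x∈ ∷ v∈xs

words-unique : ∀ {xs} k → Unique xs → Unique (words xs k)
words-unique zero    _   = [] AllPairs.∷ AllPairs.[]
words-unique (suc k) uxs = Unique.concat⁺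
  (All-map⁺ (All.tabulate λ _ → Unique.map⁺ ∷-injectiveʳ (words-unique k uxs)))
  (AllPairs-map⁺ (AllPairs.map disjoint uxs))
  where
  disjoint : ∀ {x y} → x ≢ y → Disjoint (map (x ∷_) (words _ k)) (map (y ∷_) (words _ k))
  disjoint x≢y (v∈x , v∈y)
    with _ , _ , refl ← ∈-map⁻ _ v∈x
    with _ , _ , eq ← ∈-map⁻ _ v∈y = x≢y (∷-injectiveˡ eq)

∈-S⇔↭[] : ∀ N {w} → (w ∈ S N) ⇔ (w ↭ [ N ])
∈-S⇔↭[] N {w} = mk⇔ to from
  where
  to : w ∈ S N → w ↭ [ N ]
  to w∈ with w∈words , uw ← ∈-filter⁻ unique? {xs = words [ N ] N} w∈
    with len , w⊆ ← ∈-words⁻ [ N ] N w∈words =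
    unique-InRange-length⇒↭[] uw (All.map ∈-[]⁻ w⊆) len
  from : w ↭ [ N ] → w ∈ S N
  from w↭ = ∈-filter⁺ unique?
    (∈-words⁺ [ N ] N (↭[]⇒length w↭) (All.map ∈-[]⁺ (↭[]⇒InRange w↭))) (↭[]⇒unique w↭)

S↭perms : ∀ N → S N ↭ perms N
S↭perms N = ∼bag⇒↭ (unique∧set⇒bag
  (Unique.filter⁺ unique? (words-unique N unique-[ N ])) (perms-unique N)
  (mk⇔ (perms-complete N ∘ Equivalence.to (∈-S⇔↭[] N))
       (Equivalence.from (∈-S⇔↭[] N) ∘ IsPermutation.perm ∘ perms-isPermutation N)))

module _ {a} {A : Set a} where

  sum-map-+ : ∀ (f g : A → ℕ) xs → sum (map (λ x → f x + g x) xs) ≡ sum (map f xs) + sum (map g xs)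
  sum-map-+ f g []       = refl
  sum-map-+ f g (x ∷ xs) = trans (cong (f x + g x +_) (sum-map-+ f g xs)) (interchange (f x) (g x) _ _)

  sum-map-* : ∀ c (f : A → ℕ) xs → sum (map (λ x → c * f x) xs) ≡ c * sum (map f xs)
  sum-map-* c f []       = sym (*-zeroʳ c)
  sum-map-* c f (x ∷ xs) = trans (cong (c * f x +_) (sum-map-* c f xs)) (sym (*-distribˡ-+ c (f x) _))

  sum-map-const : ∀ c (xs : List A) → sum (map (λ _ → c) xs) ≡ length xs * c
  sum-map-const c []       = refl
  sum-map-const c (x ∷ xs) = cong (c +_) (sum-map-const c xs)

  sum-map-cong : ∀ {f g : A → ℕ} xs → All (λ x → f x ≡ g x) xs → sum (map f xs) ≡ sum (map g xs)
  sum-map-cong []       []            = refl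
  sum-map-cong (x ∷ xs) (fx≡gx ∷ eqs) = cong₂ _+_ fx≡gx (sum-map-cong xs eqs)

  sum-map-concatMap : ∀ {b} {B : Set b} (f : B → ℕ) (g : A → List B) xs →
                      sum (map f (concatMap g xs)) ≡ sum (map (λ x → sum (map f (g x))) xs)
  sum-map-concatMap f g []       = refl
  sum-map-concatMap f g (x ∷ xs) = begin
    sum (map f (g x ++ concatMap g xs))               ≡⟨ cong sum (map-++ f (g x) _) ⟩
    sum (map f (g x) ++ map f (concatMap g xs))       ≡⟨ sum-++ (map f (g x)) _ ⟩
    sum (map f (g x)) + sum (map f (concatMap g xs))
      ≡⟨ cong (sum (map f (g x)) +_) (sum-map-concatMap f g xs) ⟩
    sum (map f (g x)) + sum (map (λ x → sum (map f (g x))) xs) ∎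
    where open ≡-Reasoning

  length-concatMap : ∀ {b} {B : Set b} (g : A → List B) xs →
                     length (concatMap g xs) ≡ sum (map (λ x → length (g x)) xs)
  length-concatMap g []       = refl
  length-concatMap g (x ∷ xs) = trans (length-++ (g x)) (cong (length (g x) +_) (length-concatMap g xs))

sum-indicator : ∀ {x} c {ys} → Unique ys → x ∈ ys →
                sum (map (λ y → if x ≡ᵇ y then c else 0) ys) ≡ c
sum-indicator {x} c {y ∷ ys} (y∉ys AllPairs.∷ uys) x∈ with x ≡ᵇ y | ≡ᵇ-reflects x y | x∈
... | true  | ofʸ refl | _ = trans (cong (c +_) rest≡0) (+-identityʳ c)
  where
  absent : ∀ {z} → x ≢ z → (if x ≡ᵇ z then c else 0) ≡ 0
  absent x≢z rewrite ≢⇒≡ᵇ≡false x≢z = refl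
  rest≡0 : sum (map (λ z → if x ≡ᵇ z then c else 0) ys) ≡ 0
  rest≡0 = trans (sum-map-cong ys (All.map absent y∉ys)) (trans (sum-map-const 0 ys) (*-zeroʳ (length ys)))
... | false | ofⁿ x≢y | here refl  = contradiction refl x≢y
... | false | _       | there x∈ys = sum-indicator c uys x∈ys

descentAfter : ℕ → List ℕ → ℕ
descentAfter x []      = 0
descentAfter x (y ∷ _) = if y <ᵇ x then 1 else 0

ascentAfter : ℕ → List ℕ → ℕ
ascentAfter x []      = 0
ascentAfter x (y ∷ _) = if y <ᵇ x then 0 else 1

ascents : List ℕ → ℕ
ascents []       = 0
ascents (x ∷ xs) = ascentAfter x xs + ascents xs

ascentsAt : ℕ → List ℕ → ℕ
ascentsAt m []       = 0
ascentsAt m (x ∷ xs) = (if x ≡ᵇ m then ascentAfter x xs else 0) + ascentsAt m xs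

des-∷ : ∀ x xs → des (x ∷ xs) ≡ descentAfter x xs + des xs
des-∷ x []      = refl
des-∷ x (y ∷ _) = refl

des+ascents : ∀ xs → des xs + ascents xs ≡ length xs ∸ 1
des+ascents []          = refl
des+ascents (x ∷ [])    = refl
des+ascents (x ∷ y ∷ xs) with ih ← des+ascents (y ∷ xs) | y <ᵇ x
... | true  = cong suc ih
... | false = trans (+-suc (des (y ∷ xs)) _) (cong suc ih)

sum-ascentsAt : ∀ {ys} xs → Unique ys → All (_∈ ys) xs →
                sum (map (λ m → ascentsAt m xs) ys) ≡ ascents xs
sum-ascentsAt {ys} []       _   _           = trans (sum-map-const 0 ys) (*-zeroʳ (length ys))
sum-ascentsAt {ys} (x ∷ xs) uys (x∈ ∷ xs⊆) = begin
  sum (map (λ m → (if x ≡ᵇ m then ascentAfter x xs else 0) + ascentsAt m xs) ys)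
    ≡⟨ sum-map-+ (λ m → if x ≡ᵇ m then ascentAfter x xs else 0) (λ m → ascentsAt m xs) ys ⟩
  sum (map (λ m → if x ≡ᵇ m then ascentAfter x xs else 0) ys) + sum (map (λ m → ascentsAt m xs) ys)
    ≡⟨ cong₂ _+_ (sum-indicator (ascentAfter x xs) uys x∈) (sum-ascentsAt xs uys xs⊆) ⟩
  ascentAfter x xs + ascents xs ∎
  where open ≡-Reasoning

descentAfter-insertAfter : ∀ {m n} x xs → descentAfter x (insertAfter m n xs) ≡ descentAfter x xs
descentAfter-insertAfter         x []       = refl
descentAfter-insertAfter {m} {n} x (y ∷ xs) with y ≡ᵇ m
... | true  = refl
... | false = refl

descentAfter-top : ∀ {x n} xs → x < n → All (_< n) xs →
                   descentAfter n xs ≡ descentAfter x xs + ascentAfter x xs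
descentAfter-top         []      _ _ = refl
descentAfter-top {x} {n} (y ∷ _) _ (y<n ∷ _) rewrite <⇒<ᵇ≡true y<n with y <ᵇ x
... | true  = refl
... | false = refl

-- with n between m and its successor y, the descent n > y appears and a descent m > y disappears
des-insertAfter : ∀ {m n} xs → All (_< n) xs → des (insertAfter m n xs) ≡ des xs + ascentsAt m xs
des-insertAfter []       [] = refl
des-insertAfter {m} {n} (x ∷ xs) (x<n ∷ xs<n) with x ≡ᵇ m
... | true  rewrite ≤⇒<ᵇ≡false (<⇒≤ x<n) = begin
  des (n ∷ insertAfter m n xs)                           ≡⟨ des-∷ n (insertAfter m n xs) ⟩
  descentAfter n (insertAfter m n xs) + des (insertAfter m n xs)
    ≡⟨ cong₂ _+_ (trans (descentAfter-insertAfter n xs) (descentAfter-top xs x<n xs<n))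
                 (des-insertAfter xs xs<n) ⟩
  (descentAfter x xs + ascentAfter x xs) + (des xs + ascentsAt m xs)
    ≡⟨ interchange (descentAfter x xs) _ _ _ ⟩
  (descentAfter x xs + des xs) + (ascentAfter x xs + ascentsAt m xs)
    ≡⟨ cong (_+ (ascentAfter x xs + ascentsAt m xs)) (des-∷ x xs) ⟨
  des (x ∷ xs) + (ascentAfter x xs + ascentsAt m xs) ∎
  where open ≡-Reasoning
... | false = begin
  des (x ∷ insertAfter m n xs)                                 ≡⟨ des-∷ x (insertAfter m n xs) ⟩
  descentAfter x (insertAfter m n xs) + des (insertAfter m n xs)
    ≡⟨ cong₂ _+_ (descentAfter-insertAfter x xs) (des-insertAfter xs xs<n) ⟩
  descentAfter x xs + (des xs + ascentsAt m xs)                ≡⟨ +-assoc (descentAfter x xs) _ _ ⟨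
  (descentAfter x xs + des xs) + ascentsAt m xs                ≡⟨ cong (_+ ascentsAt m xs) (des-∷ x xs) ⟨
  des (x ∷ xs) + ascentsAt m xs ∎
  where open ≡-Reasoning

des-∷ʳ-top : ∀ {n} xs → All (_< n) xs → des (xs ++ n ∷ []) ≡ des xs
des-∷ʳ-top []           []           = refl
des-∷ʳ-top (x ∷ [])     (x<n ∷ [])   rewrite ≤⇒<ᵇ≡false (<⇒≤ x<n) = refl
des-∷ʳ-top (x ∷ y ∷ xs) (_ ∷ xs<n)   = cong (_ +_) (des-∷ʳ-top (y ∷ xs) xs<n)

-- Counting

des-extensions : ∀ {N σ} → IsPermutation N σ →
  sum (map (λ c → des (Flatten (suc N) c)) (extensions N σ)) ≡ N * des (Flatten N σ) + (N ∸ 1)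
des-extensions {N} {σ} P = begin
  des (Flatten n (σ ++ n ∷ []))
    + sum (map (λ c → des (Flatten n c)) (map (λ m → insertInCycle σ m n) [ N ]))
    ≡⟨ cong₂ _+_ (trans (cong des (AppendFixed.Flatten-appendFixed P)) (des-∷ʳ-top F F<n))
                 (trans (cong sum (sym (map-∘ [ N ]))) (sum-map-cong [ N ] (All.tabulate inserted))) ⟩
  D + sum (map (λ m → D + ascentsAt m F) [ N ])
    ≡⟨ cong (D +_) (sum-map-+ (λ _ → D) (λ m → ascentsAt m F) [ N ]) ⟩
  D + (sum (map (λ _ → D) [ N ]) + sum (map (λ m → ascentsAt m F) [ N ]))
    ≡⟨ cong₂ (λ a b → D + (a + b)) (trans (sum-map-const D [ N ]) (cong (_* D) length-[ N ]))
                                   (sum-ascentsAt F unique-[ N ] (All.map ∈-[]⁺ (↭[]⇒InRange flatten))) ⟩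
  D + (N * D + ascents F)
    ≡⟨ x+[y+z]≡y+[x+z] D (N * D) (ascents F) ⟩
  N * D + (D + ascents F)
    ≡⟨ cong (N * D +_) (trans (des+ascents F) (cong (_∸ 1) (↭[]⇒length flatten))) ⟩
  N * D + (N ∸ 1) ∎
  where
  open ≡-Reasoning
  open IsPermutation P
  n = suc N
  F = Flatten N σ
  D = des F
  F<n : All (_< n) F
  F<n = All.map (s≤s ∘ proj₂) (↭[]⇒InRange flatten)
  inserted : ∀ {m} → m ∈ [ N ] → des (Flatten n (insertInCycle σ m n)) ≡ D + ascentsAt m F
  inserted m∈ = trans (cong des (InsertInCycle.Flatten-insertInCycle P (∈-[]⁻ m∈))) (des-insertAfter F F<n)
  x+[y+z]≡y+[x+z] : ∀ x y z → x + (y + z) ≡ y + (x + z)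
  x+[y+z]≡y+[x+z] = solve-∀

length-perms : ∀ N → length (perms N) ≡ N !
length-perms zero    = refl
length-perms (suc N) = begin
  length (concatMap (extensions N) (perms N))                  ≡⟨ length-concatMap (extensions N) (perms N) ⟩
  sum (map (λ σ → length (extensions N σ)) (perms N))
    ≡⟨ sum-map-cong (perms N) (All.tabulate λ _ → length-extensions) ⟩
  sum (map (λ _ → suc N) (perms N))                            ≡⟨ sum-map-const (suc N) (perms N) ⟩
  length (perms N) * suc N                                     ≡⟨ cong (_* suc N) (length-perms N) ⟩
  N ! * suc N                                                  ≡⟨ *-comm (N !) (suc N) ⟩
  suc N ! ∎
  where
  open ≡-Reasoning
  length-extensions : ∀ {σ} → length (extensions N σ) ≡ suc N
  length-extensions = cong suc (trans (length-map _ [ N ]) length-[ N ])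

totalDesPerms : ℕ → ℕ
totalDesPerms N = sum (map (λ π → des (Flatten N π)) (perms N))

totalDesPerms-suc : ∀ N → totalDesPerms (suc N) ≡ N * totalDesPerms N + N ! * (N ∸ 1)
totalDesPerms-suc N = begin
  sum (map (λ π → des (Flatten (suc N) π)) (concatMap (extensions N) (perms N)))
    ≡⟨ sum-map-concatMap (λ π → des (Flatten (suc N) π)) (extensions N) (perms N) ⟩
  sum (map (λ σ → sum (map (λ π → des (Flatten (suc N) π)) (extensions N σ))) (perms N))
    ≡⟨ sum-map-cong (perms N) (All.tabulate (des-extensions ∘ perms-isPermutation N)) ⟩
  sum (map (λ σ → N * des (Flatten N σ) + (N ∸ 1)) (perms N))
    ≡⟨ sum-map-+ (λ σ → N * des (Flatten N σ)) (λ _ → N ∸ 1) (perms N) ⟩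
  sum (map (λ σ → N * des (Flatten N σ)) (perms N)) + sum (map (λ _ → N ∸ 1) (perms N))
    ≡⟨ cong₂ _+_ (sum-map-* N (λ σ → des (Flatten N σ)) (perms N))
                 (trans (sum-map-const (N ∸ 1) (perms N)) (cong (_* (N ∸ 1)) (length-perms N))) ⟩
  N * totalDesPerms N + N ! * (N ∸ 1) ∎
  where open ≡-Reasoning

totalDesPerms-closed : ∀ N → 2 * totalDesPerms (suc N) ≡ N ! * (N * (N ∸ 1))
totalDesPerms-closed zero    = cong (2 *_) (totalDesPerms-suc 0)
totalDesPerms-closed (suc N) = begin
  2 * totalDesPerms (suc (suc N))
    ≡⟨ cong (2 *_) (totalDesPerms-suc (suc N)) ⟩
  2 * (suc N * totalDesPerms (suc N) + suc N ! * N)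
    ≡⟨ regroup (suc N) (totalDesPerms (suc N)) (suc N !) N ⟩
  suc N * (2 * totalDesPerms (suc N)) + 2 * (suc N ! * N)
    ≡⟨ cong (λ t → suc N * t + 2 * (suc N ! * N)) (totalDesPerms-closed N) ⟩
  suc N * (N ! * (N * (N ∸ 1))) + 2 * (suc N ! * N)
    ≡⟨ factor (suc N) (N !) N (N ∸ 1) ⟩
  suc N ! * (N * (N ∸ 1) + 2 * N)
    ≡⟨ cong (suc N ! *_) (n*[n∸1]+2n≡[1+n]*n N) ⟩
  suc N ! * (suc N * N) ∎
  where
  open ≡-Reasoning
  regroup : ∀ n t f k → 2 * (n * t + f * k) ≡ n * (2 * t) + 2 * (f * k)
  regroup = solve-∀
  factor : ∀ n f m k → n * (f * (m * k)) + 2 * ((n * f) * m) ≡ (n * f) * (m * k + 2 * m)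
  factor = solve-∀
  n*[n∸1]+2n≡[1+n]*n : ∀ n → n * (n ∸ 1) + 2 * n ≡ suc n * n
  n*[n∸1]+2n≡[1+n]*n zero    = refl
  n*[n∸1]+2n≡[1+n]*n (suc n) = [1+n]*n+2[1+n]≡[2+n]*[1+n] n
    where
    [1+n]*n+2[1+n]≡[2+n]*[1+n] : ∀ n → suc n * n + 2 * suc n ≡ suc (suc n) * suc n
    [1+n]*n+2[1+n]≡[2+n]*[1+n] = solve-∀

length-S : ∀ N → length (S N) ≡ N !
length-S N = trans (↭-length (S↭perms N)) (length-perms N)

totalDes≡totalDesPerms : ∀ N → totalDes N ≡ totalDesPerms N
totalDes≡totalDesPerms N = sum-↭ (↭-map⁺ (λ π → des (Flatten N π)) (S↭perms N))

corollary2p2 : (n : ℕ) → 1 ≤ n →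
    totalDes n * (2 * n) ≡ length (S n) * ((n ∸ 1) * (n ∸ 2))
corollary2p2 (suc N) _ = begin
  totalDes (suc N) * (2 * suc N)       ≡⟨ cong (_* (2 * suc N)) (totalDes≡totalDesPerms (suc N)) ⟩
  totalDesPerms (suc N) * (2 * suc N)  ≡⟨ t*[2*n]≡n*[2*t] (totalDesPerms (suc N)) (suc N) ⟩
  suc N * (2 * totalDesPerms (suc N))  ≡⟨ cong (suc N *_) (totalDesPerms-closed N) ⟩
  suc N * (N ! * (N * (N ∸ 1)))        ≡⟨ *-assoc (suc N) (N !) _ ⟨
  suc N ! * (N * (N ∸ 1))              ≡⟨ cong (_* (N * (N ∸ 1))) (length-S (suc N)) ⟨
  length (S (suc N)) * (N * (N ∸ 1))   ∎
  where
  open ≡-Reasoning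
  t*[2*n]≡n*[2*t] : ∀ t n → t * (2 * n) ≡ n * (2 * t)
  t*[2*n]≡n*[2*t] = solve-∀
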